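{- For every positive integer $k$, $$\lim_{N \to \infty}\frac{\#\{0 \le n \le N : p(n,k) \text{ is odd}\}}{N} \ge \frac{2}{k(k+1)}.$$
   Context: For a nonnegative integer $n$ and a positive integer $k$, $p(n,k)$ denotes the number of partitions of $n$ into parts each less than or equal to $k$ (so $p(0,k)=1$); equivalently, $\sum_{n\ge 0} p(n,k)q^n = \prod_{i=1}^{k} \frac{1}{1-q^i}$. -}

module Defs where

open import Data.Nat using (ℕ; zero; suc; _+_; _*_; _∸_; _≤?_; _%_)
open import Data.Nat.Properties using (_≟_)
open import Data.List using (List; filter; length; upTo)
open import Data.Integer using (+_)
open import Data.Rational using (ℚ; 0ℚ; _/_)
open import Relation.Nullary using (yes; no)

-- p n k : number of partitions of n into parts each ≤ k.
-- Defined by the generating function ∏_{i=1}^{k} 1/(1-q^i):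
--   p n 0 = [n = 0],
--   p n (k+1) = Σ_{j ≥ 0, j(k+1) ≤ n} p (n - j(k+1)) k   (j = multiplicity of part k+1).
mutual
  p : ℕ → ℕ → ℕ
  p zero    zero    = 1
  p (suc n) zero    = 0
  p n       (suc k) = sumMult n k (suc n)

  sumMult : ℕ → ℕ → ℕ → ℕ
  sumMult n k zero    = 0
  sumMult n k (suc j) with j * suc k ≤? n
  ... | yes _ = p (n ∸ j * suc k) k + sumMult n k j
  ... | no  _ = sumMult n k j

oddCount : ℕ → ℕ → ℕ
oddCount k N = length (filter (λ n → p n k % 2 ≟ 1) (upTo (suc N)))

-- a / d as a rational; the value at d = 0 is an irrelevant dummy (0).
ratio : ℕ → ℕ → ℚ
ratio a zero    = 0ℚ
ratio a (suc d) = (+ a) / suc d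

module Submission where

-- The proof rests on two facts about the parities of p(·,k), both proved
-- by induction on k from the recurrence
--   p(m+k+1, k+1) = p(m+k+1, k) + p(m, k+1),
-- which mod 2 says b(x+s) = a(x+s) + b(x) for a = p(·,k) mod 2,
-- b = p(·,k+1) mod 2 and s = k+1 (a "parity step"):
--   * periodicity: if a has period P then b has period 2·s·P, so each
--     p(·,k) mod 2 is periodic and the number of odd values in [0, N]
--     stays within a constant of a line c·N/P;
--   * windows: if a has an odd value in every window of length w, then b
--     has one in every window of length s + w; since p(n,1) = 1, every
--     window of length T(k) = k(k+1)/2 contains an odd value of p(·,k),
--     so at least about N/T(k) of the n ≤ N give odd p(n,k).
-- The first fact makes the ratios Cauchy, the second bounds them below
-- by 2/(k(k+1)) − ε.

module Inequalities where

  open import Data.Nat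
  open import Data.Nat.Properties
  open import Data.Nat.Tactic.RingSolver using (solve-∀)
  open import Data.Product using (_×_; _,_)
  open import Relation.Binary.PropositionalEquality

  +-swapʳ : ∀ x y z → x + y + z ≡ x + z + y
  +-swapʳ = solve-∀

  +-shuffle : ∀ x y z → x + (y + z) ≡ x + z + y
  +-shuffle = solve-∀

  -- WithinLine P c K n y: the point (n, y) lies within vertical distance
  -- K/P of the line y = (c/P)·n, i.e. |P·y − c·n| ≤ K.
  WithinLine : ℕ → ℕ → ℕ → ℕ → ℕ → Set
  WithinLine P c K n y = (P * y ≤ c * n + K) × (c * n ≤ P * y + K)

  linear-bounds-arith : ∀ P x c r q → x ≤ P → c ≤ P → r ≤ P →
    WithinLine P c (P * P) (r + q * P) (x + q * c)
  linear-bounds-arith P x c r q x≤P c≤P r≤P = upper , lower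
    where
    open ≤-Reasoning
    X : ℕ
    X = P * (q * c)
    upper : P * (x + q * c) ≤ c * (r + q * P) + P * P
    upper = begin
      P * (x + q * c)             ≡⟨ *-distribˡ-+ P x (q * c) ⟩
      P * x + X                   ≤⟨ +-monoˡ-≤ X (*-monoʳ-≤ P x≤P) ⟩
      P * P + X                   ≤⟨ +-monoˡ-≤ X (m≤n+m (P * P) (c * r)) ⟩
      c * r + P * P + X           ≡⟨ expand P c r q ⟩
      c * (r + q * P) + P * P     ∎
      where
      expand : ∀ P c r q → c * r + P * P + P * (q * c) ≡ c * (r + q * P) + P * P
      expand = solve-∀
    lower : c * (r + q * P) ≤ P * (x + q * c) + P * P
    lower = begin
      c * (r + q * P)             ≡⟨ expand P c r q ⟩
      c * r + X                   ≤⟨ +-monoˡ-≤ X (*-mono-≤ c≤P r≤P) ⟩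
      P * P + X                   ≤⟨ +-monoˡ-≤ X (m≤n+m (P * P) (P * x)) ⟩
      P * x + P * P + X           ≡⟨ collect P x c q ⟩
      P * (x + q * c) + P * P     ∎
      where
      expand : ∀ P c r q → c * (r + q * P) ≡ c * r + P * (q * c)
      expand = solve-∀
      collect : ∀ P x c q → P * x + P * P + P * (q * c) ≡ P * (x + q * c) + P * P
      collect = solve-∀

  -- If P·a ≤ c·M + K and c·N ≤ P·b + K, then a/M and b/N are both within
  -- K/(P·M), K/(P·N) of c/P; once M, N > 2KF this gives a/M − b/N < E/F.
  -- Stated cross-multiplied.
  cauchy-cross : ∀ {P c K F E M N a b} .{{_ : NonZero P}} .{{_ : NonZero E}} →
    P * a ≤ c * M + K → c * N ≤ P * b + K → 2 * K * F < M → 2 * K * F < N →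
    a * N * F < E * (M * N) + b * M * F
  cauchy-cross {P} {c} {K} {F} {E} {M} {N} {a} {b} upper lower M-large N-large =
    *-cancelˡ-< P _ _ (begin-strict
      P * (a * N * F)                     ≡⟨ regroup₁ P a N F ⟩
      (P * a) * (N * F)                   ≤⟨ *-monoˡ-≤ (N * F) upper ⟩
      (c * M + K) * (N * F)               ≡⟨ regroup₂ c M K N F ⟩
      (c * N) * (M * F) + K * F * N       ≤⟨ +-monoˡ-≤ (K * F * N) (*-monoˡ-≤ (M * F) lower) ⟩
      (P * b + K) * (M * F) + K * F * N   ≡⟨ regroup₃ P b K M F N ⟩
      P * (b * M * F) + K * F * (M + N)   <⟨ +-monoʳ-< (P * (b * M * F)) error<MN ⟩
      P * (b * M * F) + M * N             ≤⟨ +-monoʳ-≤ (P * (b * M * F)) MN≤PEMN ⟩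
      P * (b * M * F) + P * (E * (M * N)) ≡⟨ regroup₄ P (b * M * F) (E * (M * N)) ⟩
      P * (E * (M * N) + b * M * F)       ∎)
    where
    open ≤-Reasoning
    instance
      M≢0 : NonZero M
      M≢0 = >-nonZero (≤-trans (s≤s z≤n) M-large)
      N≢0 : NonZero N
      N≢0 = >-nonZero (≤-trans (s≤s z≤n) N-large)

    error<MN : K * F * (M + N) < M * N
    error<MN = *-cancelˡ-< 2 _ _ (begin-strict
      2 * (K * F * (M + N))           ≡⟨ distribute K F M N ⟩
      2 * K * F * M + 2 * K * F * N   <⟨ +-mono-< (*-monoˡ-< M N-large) (*-monoˡ-< N M-large) ⟩
      N * M + M * N                   ≡⟨ double M N ⟩
      2 * (M * N)                     ∎)
      where
      distribute : ∀ K F M N → 2 * (K * F * (M + N)) ≡ 2 * K * F * M + 2 * K * F * N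
      distribute = solve-∀
      double : ∀ M N → N * M + M * N ≡ 2 * (M * N)
      double = solve-∀

    MN≤PEMN : M * N ≤ P * (E * (M * N))
    MN≤PEMN = ≤-trans (m≤n*m (M * N) E) (m≤n*m (E * (M * N)) P)

    regroup₁ : ∀ P a N F → P * (a * N * F) ≡ (P * a) * (N * F)
    regroup₁ = solve-∀
    regroup₂ : ∀ c M K N F → (c * M + K) * (N * F) ≡ (c * N) * (M * F) + K * F * N
    regroup₂ = solve-∀
    regroup₃ : ∀ P b K M F N → (P * b + K) * (M * F) + K * F * N ≡ P * (b * M * F) + K * F * (M + N)
    regroup₃ = solve-∀
    regroup₄ : ∀ P x y → P * x + P * y ≡ P * (y + x)
    regroup₄ = solve-∀

  above-cross : ∀ {u d w a N F E} .{{_ : NonZero d}} .{{_ : NonZero E}} →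
    u * N ≤ d * a + w → w * F ≤ N → u * F * N ≤ a * (d * F) + E * d * N
  above-cross {u} {d} {w} {a} {N} {F} {E} bound N-large = begin
    u * F * N               ≡⟨ regroup u F N ⟩
    F * (u * N)             ≤⟨ *-monoʳ-≤ F bound ⟩
    F * (d * a + w)         ≡⟨ expand F d a w ⟩
    a * (d * F) + w * F     ≤⟨ +-monoʳ-≤ (a * (d * F)) N-large ⟩
    a * (d * F) + N         ≤⟨ +-monoʳ-≤ (a * (d * F)) N≤EdN ⟩
    a * (d * F) + E * d * N ∎
    where
    open ≤-Reasoning
    regroup : ∀ u F N → u * F * N ≡ F * (u * N)
    regroup = solve-∀
    expand : ∀ F d a w → F * (d * a + w) ≡ a * (d * F) + w * F
    expand = solve-∀
    N≤EdN : N ≤ E * d * N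
    N≤EdN = m≤n*m N (E * d) {{m*n≢0 E d}}

module PartitionParity where

  open import Defs using (p; sumMult; oddCount)
  open import Data.Nat
  open import Data.Nat.Properties
  open import Data.Nat.DivMod using (_/_; _%_; m≡m%n+[m/n]*n; m%n<n; m/n*n≤m; [m+n]%n≡m%n)
  open import Data.Nat.Tactic.RingSolver using (solve-∀)
  open import Data.Parity.Base as ℙ using (Parity; 0ℙ; 1ℙ)
  open import Data.Parity.Properties as ℙP using (+-homo-+)
  open import Data.List using ([_]; _++_; filter; length; upTo)
  open import Data.List.Properties using (upTo-∷ʳ; filter-++; length-++; filter-≐)
  open import Data.Product using (Σ; _×_; _,_)
  open import Data.Sum using (inj₁; inj₂)
  open import Relation.Nullary using (Dec; yes; no; contradiction)
  open import Relation.Binary.PropositionalEquality hiding ([_])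
  open Inequalities using (+-swapʳ; +-shuffle; WithinLine; linear-bounds-arith)

  -- Shifting n by k+1 shifts the multiplicity j of the part k+1 by one; the
  -- two comparisons j(k+1) ≤ n always agree, so the mixed cases are absurd.
  sumMult-shift : ∀ m k J →
    sumMult (m + suc k) k (suc J) ≡ p (m + suc k) k + sumMult m k J
  sumMult-shift m k zero = refl
  sumMult-shift m k (suc J) with suc J * suc k ≤? m + suc k | J * suc k ≤? m
  ... | yes _ | yes _ = begin
      p (m + suc k ∸ (suc k + J * suc k)) k + sumMult (m + suc k) k (suc J)
        ≡⟨ cong₂ _+_ (cong (λ x → p x k) (shifted-difference (J * suc k)))
                     (sumMult-shift m k J) ⟩
      p (m ∸ J * suc k) k + (p (m + suc k) k + sumMult m k J)
        ≡⟨ swap-first (p (m ∸ J * suc k) k) (p (m + suc k) k) (sumMult m k J) ⟩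
      p (m + suc k) k + (p (m ∸ J * suc k) k + sumMult m k J) ∎
    where
    open ≡-Reasoning
    shifted-difference : ∀ x → m + suc k ∸ (suc k + x) ≡ m ∸ x
    shifted-difference x =
      trans (cong (_∸ (suc k + x)) (+-comm m (suc k))) ([m+n]∸[m+o]≡n∸o (suc k) m x)
    swap-first : ∀ a b c → a + (b + c) ≡ b + (a + c)
    swap-first = solve-∀
  ... | yes fits | no ¬fits = contradiction (+-cancelʳ-≤ (suc k) _ _ fits′) ¬fits
    where
    fits′ : J * suc k + suc k ≤ m + suc k
    fits′ = subst (_≤ m + suc k) (+-comm (suc k) (J * suc k)) fits
  ... | no ¬fits | yes fits = contradiction fits′ ¬fits
    where
    fits′ : suc J * suc k ≤ m + suc k
    fits′ = subst (_≤ m + suc k) (+-comm (J * suc k) (suc k)) (+-monoˡ-≤ (suc k) fits)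
  ... | no _ | no _ = sumMult-shift m k J

  sumMult-saturates : ∀ m k d → sumMult m k (suc m + d) ≡ sumMult m k (suc m)
  sumMult-saturates m k zero = cong (sumMult m k) (+-identityʳ (suc m))
  sumMult-saturates m k (suc d) rewrite +-suc m d with (suc m + d) * suc k ≤? m
  ... | yes too-big = contradiction too-big (<⇒≱ (≤-trans (m≤m+n (suc m) d) (m≤m*n (suc m + d) (suc k))))
  ... | no _ = sumMult-saturates m k d

  p-by-multiplicity : ∀ m k → p m (suc k) ≡ sumMult m k (suc m)
  p-by-multiplicity zero k = refl
  p-by-multiplicity (suc m) k = refl

  -- p(m+k+1, k+1) = p(m+k+1, k) + p(m, k+1): a partition of m+k+1 into
  -- parts ≤ k+1 either has no part k+1, or one copy of it can be removed.
  p-recurrence : ∀ m k → p (m + suc k) (suc k) ≡ p (m + suc k) k + p m (suc k)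
  p-recurrence m k = begin
    p (m + suc k) (suc k)                       ≡⟨ p-by-multiplicity (m + suc k) k ⟩
    sumMult (m + suc k) k (suc (m + suc k))     ≡⟨ sumMult-shift m k (m + suc k) ⟩
    p (m + suc k) k + sumMult m k (m + suc k)   ≡⟨ cong (p (m + suc k) k +_) tail ⟩
    p (m + suc k) k + p m (suc k)               ∎
    where
    open ≡-Reasoning
    tail : sumMult m k (m + suc k) ≡ p m (suc k)
    tail = begin
      sumMult m k (m + suc k) ≡⟨ cong (sumMult m k) (+-suc m k) ⟩
      sumMult m k (suc m + k) ≡⟨ sumMult-saturates m k k ⟩
      sumMult m k (suc m)     ≡⟨ p-by-multiplicity m k ⟨
      p m (suc k)             ∎

  -- Only the all-ones partition uses parts ≤ 1.
  p-parts≤1 : ∀ n → p n 1 ≡ 1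
  p-parts≤1 zero = refl
  p-parts≤1 (suc n) = begin
    p (suc n) 1         ≡⟨ cong (λ x → p x 1) (+-comm 1 n) ⟩
    p (n + 1) 1         ≡⟨ p-recurrence n 0 ⟩
    p (n + 1) 0 + p n 1 ≡⟨ cong (λ x → p x 0 + p n 1) (+-comm n 1) ⟩
    p n 1               ≡⟨ p-parts≤1 n ⟩
    1                   ∎
    where open ≡-Reasoning

  oddness : ℕ → ℕ → Parity
  oddness k n = parity (p n k)

  oddness-recurrence : ∀ k x →
    oddness (suc k) (x + suc k) ≡ oddness k (x + suc k) ℙ.+ oddness (suc k) x
  oddness-recurrence k x = trans (cong parity (p-recurrence x k)) (+-homo-+ (p (x + suc k) k) (p x (suc k)))

  oddness-parts≤1 : ∀ n → oddness 1 n ≡ 1ℙ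
  oddness-parts≤1 n = cong parity (p-parts≤1 n)

  +-cancelʳ-self : ∀ x y → (x ℙ.+ y) ℙ.+ y ≡ x
  +-cancelʳ-self x y =
    trans (ℙP.+-assoc x y y) (trans (cong (x ℙ.+_) (ℙP.p+p≡0ℙ y)) (ℙP.+-identityʳ x))

  +-cancelˡ-self : ∀ x y → x ℙ.+ (x ℙ.+ y) ≡ y
  +-cancelˡ-self x y = trans (sym (ℙP.+-assoc x x y)) (cong (ℙ._+ y) (ℙP.p+p≡0ℙ x))

  +-cancel-common : ∀ x y z → (x ℙ.+ y) ℙ.+ (x ℙ.+ z) ≡ y ℙ.+ z
  +-cancel-common x y z = begin
    (x ℙ.+ y) ℙ.+ (x ℙ.+ z) ≡⟨ cong (ℙ._+ (x ℙ.+ z)) (ℙP.+-comm x y) ⟩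
    (y ℙ.+ x) ℙ.+ (x ℙ.+ z) ≡⟨ ℙP.+-assoc y x (x ℙ.+ z) ⟩
    y ℙ.+ (x ℙ.+ (x ℙ.+ z)) ≡⟨ cong (y ℙ.+_) (+-cancelˡ-self x z) ⟩
    y ℙ.+ z                 ∎
    where open ≡-Reasoning

  Periodic : {A : Set} → (ℕ → A) → ℕ → Set
  Periodic f P = ∀ n → f (n + P) ≡ f n

  periodic-multiple : ∀ {A : Set} {f : ℕ → A} {P} → Periodic f P → ∀ j → Periodic f (j * P)
  periodic-multiple {f = f} per zero n = cong f (+-identityʳ n)
  periodic-multiple {f = f} {P} per (suc j) n = begin
    f (n + (P + j * P)) ≡⟨ cong f (+-shuffle n P (j * P)) ⟩
    f (n + j * P + P)   ≡⟨ per (n + j * P) ⟩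
    f (n + j * P)       ≡⟨ periodic-multiple per j n ⟩
    f n                 ∎
    where open ≡-Reasoning

  -- The abstract shape of the mod-2 recurrence: b(x+s) = a(x+s) + b(x).
  ParityStep : ℕ → (ℕ → Parity) → (ℕ → Parity) → Set
  ParityStep s a b = ∀ x → b (x + s) ≡ a (x + s) ℙ.+ b x

  -- Periodicity propagates through a parity step: with L = s·P, the
  -- difference D(n) = b(n+L) + b(n) has period s (the a-terms cancel since
  -- P divides L), hence period L, so b(n+2L) = D(n+L) + D(n) + b(n) = b(n).
  period-lift : ∀ {s a b P} → ParityStep s a b → Periodic a P → Periodic b (s * P + s * P)
  period-lift {s} {a} {b} {P} step per n = begin
    b (n + (L + L))      ≡⟨ cong b (sym (+-assoc n L L)) ⟩
    b (n + L + L)        ≡⟨ shift-by-L (n + L) ⟩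
    D (n + L) ℙ.+ b (n + L) ≡⟨ cong₂ ℙ._+_ (D-periodic-L n) (shift-by-L n) ⟩
    D n ℙ.+ (D n ℙ.+ b n) ≡⟨ +-cancelˡ-self (D n) (b n) ⟩
    b n                  ∎
    where
    open ≡-Reasoning
    L : ℕ
    L = s * P
    D : ℕ → Parity
    D m = b (m + L) ℙ.+ b m

    shift-by-L : ∀ m → b (m + L) ≡ D m ℙ.+ b m
    shift-by-L m = sym (+-cancelʳ-self (b (m + L)) (b m))

    a-invariant : ∀ m → a (m + L + s) ≡ a (m + s)
    a-invariant m = trans (cong a (+-swapʳ m L s)) (periodic-multiple per s (m + s))

    D-periodic : Periodic D s
    D-periodic m = begin
      b (m + s + L) ℙ.+ b (m + s)
        ≡⟨ cong (λ x → b x ℙ.+ b (m + s)) (+-swapʳ m s L) ⟩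
      b (m + L + s) ℙ.+ b (m + s)
        ≡⟨ cong₂ ℙ._+_ (step (m + L)) (step m) ⟩
      (a (m + L + s) ℙ.+ b (m + L)) ℙ.+ (a (m + s) ℙ.+ b m)
        ≡⟨ cong (λ x → (x ℙ.+ b (m + L)) ℙ.+ (a (m + s) ℙ.+ b m)) (a-invariant m) ⟩
      (a (m + s) ℙ.+ b (m + L)) ℙ.+ (a (m + s) ℙ.+ b m)
        ≡⟨ +-cancel-common (a (m + s)) (b (m + L)) (b m) ⟩
      D m ∎

    D-periodic-L : Periodic D L
    D-periodic-L m = trans (cong D (cong (m +_) (*-comm s P))) (periodic-multiple D-periodic P m)

  OddInEveryWindow : (ℕ → Parity) → ℕ → Set
  OddInEveryWindow f w = ∀ t → Σ ℕ λ i → i < w × f (t + i) ≡ 1ℙ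

  -- If a has an odd value in every window of length w, then b has one in
  -- every window of length s + w: where a(t+s+i) is odd, one of b(t+i)
  -- and b(t+i+s) is odd.
  window-lift : ∀ {s a b w} → ParityStep s a b → OddInEveryWindow a w → OddInEveryWindow b (s + w)
  window-lift {s} {a} {b} {w} step odd-a t with odd-a (t + s)
  ... | i , i<w , a-odd with b (t + i) in b-value
  ...   | 1ℙ = i , ≤-trans i<w (m≤n+m w s) , b-value
  ...   | 0ℙ = s + i , +-monoʳ-< s i<w , b-odd
    where
    open ≡-Reasoning
    b-odd : b (t + (s + i)) ≡ 1ℙ
    b-odd = begin
      b (t + (s + i))          ≡⟨ cong b (+-shuffle t s i) ⟩
      b (t + i + s)            ≡⟨ step (t + i) ⟩
      a (t + i + s) ℙ.+ b (t + i) ≡⟨ cong₂ ℙ._+_ (cong a (+-swapʳ t i s)) b-value ⟩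
      a (t + s + i) ℙ.+ 0ℙ     ≡⟨ cong (ℙ._+ 0ℙ) a-odd ⟩
      1ℙ                       ∎

  parityValue : Parity → ℕ
  parityValue 0ℙ = 0
  parityValue 1ℙ = 1

  parityValue≤1 : ∀ x → parityValue x ≤ 1
  parityValue≤1 0ℙ = z≤n
  parityValue≤1 1ℙ = ≤-refl

  %2≡parityValue : ∀ n → n % 2 ≡ parityValue (parity n)
  %2≡parityValue zero          = refl
  %2≡parityValue (suc zero)    = refl
  %2≡parityValue (suc (suc n)) =
    trans (cong (_% 2) (+-comm 2 n)) (trans ([m+n]%n≡m%n n 2) (%2≡parityValue n))

  count : (ℕ → Parity) → ℕ → ℕ
  count f zero    = 0
  count f (suc n) = count f n + parityValue (f n)

  count-filter : ∀ f n → length (filter (λ i → f i ℙP.≟ 1ℙ) (upTo n)) ≡ count f n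
  count-filter f zero    = refl
  count-filter f (suc n) = begin
    length (filter Odd? (upTo (suc n)))
      ≡⟨ cong (λ xs → length (filter Odd? xs)) (upTo-∷ʳ n) ⟨
    length (filter Odd? (upTo n ++ [ n ]))
      ≡⟨ cong length (filter-++ Odd? (upTo n) [ n ]) ⟩
    length (filter Odd? (upTo n) ++ filter Odd? [ n ])
      ≡⟨ length-++ (filter Odd? (upTo n)) ⟩
    length (filter Odd? (upTo n)) + length (filter Odd? [ n ])
      ≡⟨ cong₂ _+_ (count-filter f n) last ⟩
    count f n + parityValue (f n) ∎
    where
    open ≡-Reasoning
    Odd? : (i : ℕ) → Dec (f i ≡ 1ℙ)
    Odd? i = f i ℙP.≟ 1ℙ
    last : length (filter Odd? [ n ]) ≡ parityValue (f n)
    last with f n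
    ... | 0ℙ = refl
    ... | 1ℙ = refl

  count≤ : ∀ f n → count f n ≤ n
  count≤ f zero    = z≤n
  count≤ f (suc n) = subst (count f n + parityValue (f n) ≤_) (+-comm n 1)
                           (+-mono-≤ (count≤ f n) (parityValue≤1 (f n)))

  count-mono : ∀ f {m n} → m ≤ n → count f m ≤ count f n
  count-mono f {n = zero}  z≤n = ≤-refl
  count-mono f {n = suc n} m≤1+n with m≤n⇒m<n∨m≡n m≤1+n
  ... | inj₁ (s≤s m≤n) = ≤-trans (count-mono f m≤n) (m≤m+n (count f n) (parityValue (f n)))
  ... | inj₂ refl      = ≤-refl

  count-window : ∀ {f w} → OddInEveryWindow f w → ∀ t → suc (count f t) ≤ count f (t + w)
  count-window {f} {w} odd-f t with odd-f t
  ... | i , i<w , f-odd = begin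
    suc (count f t)              ≤⟨ s≤s (count-mono f (m≤m+n t i)) ⟩
    suc (count f (t + i))        ≡⟨ +-comm 1 (count f (t + i)) ⟩
    count f (t + i) + 1          ≡⟨ cong (λ x → count f (t + i) + parityValue x) f-odd ⟨
    count f (suc (t + i))        ≤⟨ count-mono f (subst (_≤ t + w) (+-suc t i) (+-monoʳ-≤ t i<w)) ⟩
    count f (t + w)              ∎
    where open ≤-Reasoning

  -- The q disjoint windows [0, w), …, [(q−1)w, qw) each contain an odd value.
  windows-counted : ∀ {f w} → OddInEveryWindow f w → ∀ q → q ≤ count f (q * w)
  windows-counted odd-f zero    = z≤n
  windows-counted {f} {w} odd-f (suc q) = begin
    suc q                 ≤⟨ s≤s (windows-counted odd-f q) ⟩
    suc (count f (q * w)) ≤⟨ count-window odd-f (q * w) ⟩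
    count f (q * w + w)   ≡⟨ cong (count f) (+-comm (q * w) w) ⟩
    count f (suc q * w)   ∎
    where open ≤-Reasoning

  -- An odd value in every window of length w gives density at least 1/w:
  -- writing n = q·w + r with r < w, we have n < w·q + w ≤ w·count(n) + w.
  window-density : ∀ {f w} .{{_ : NonZero w}} → OddInEveryWindow f w → ∀ n → n < w * count f n + w
  window-density {f} {w} odd-f n = begin-strict
    n                       ≡⟨ m≡m%n+[m/n]*n n w ⟩
    n % w + q * w           <⟨ +-monoˡ-< (q * w) (m%n<n n w) ⟩
    w + q * w               ≡⟨ +-comm w (q * w) ⟩
    q * w + w               ≤⟨ +-monoˡ-≤ w (*-monoˡ-≤ w q≤count) ⟩
    count f n * w + w       ≡⟨ cong (_+ w) (*-comm (count f n) w) ⟩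
    w * count f n + w       ∎
    where
    open ≤-Reasoning
    q : ℕ
    q = n / w
    q≤count : q ≤ count f n
    q≤count = ≤-trans (windows-counted odd-f q) (count-mono f (m/n*n≤m n w))

  count-shift : ∀ {f P} → Periodic f P → ∀ n → count f (n + P) ≡ count f n + count f P
  count-shift per zero    = refl
  count-shift {f} {P} per (suc n) = begin
    count f (n + P) + parityValue (f (n + P)) ≡⟨ cong₂ _+_ (count-shift per n) (cong parityValue (per n)) ⟩
    count f n + count f P + parityValue (f n) ≡⟨ +-swapʳ (count f n) (count f P) (parityValue (f n)) ⟩
    count f n + parityValue (f n) + count f P ∎
    where open ≡-Reasoning

  count-periods : ∀ {f P} → Periodic f P → ∀ r q → count f (r + q * P) ≡ count f r + q * count f P
  count-periods {f} per r zero    = trans (cong (count f) (+-identityʳ r)) (sym (+-identityʳ (count f r)))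
  count-periods {f} {P} per r (suc q) = begin
    count f (r + (P + q * P))     ≡⟨ cong (count f) (+-shuffle r P (q * P)) ⟩
    count f (r + q * P + P)       ≡⟨ count-shift per (r + q * P) ⟩
    count f (r + q * P) + c       ≡⟨ cong (_+ c) (count-periods per r q) ⟩
    count f r + q * c + c         ≡⟨ regroup (count f r) q c ⟩
    count f r + (c + q * c)       ∎
    where
    open ≡-Reasoning
    c : ℕ
    c = count f P
    regroup : ∀ x y z → x + y * z + z ≡ x + (z + y * z)
    regroup = solve-∀

  -- A sequence of period P satisfies |P·count(n) − count(P)·n| ≤ P²:
  -- write n = r + q·P with r < P and count whole periods.
  linear-bounds : ∀ {f P} .{{_ : NonZero P}} → Periodic f P → ∀ n →
    WithinLine P (count f P) (P * P) n (count f n)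
  linear-bounds {f} {P} per n =
    subst (λ m → WithinLine P c (P * P) m (count f m)) (sym n≡r+qP)
      (subst (WithinLine P c (P * P) (r + q * P)) (sym (count-periods per r q))
        (linear-bounds-arith P (count f r) c r q (≤-trans (count≤ f r) r≤P) (count≤ f P) r≤P))
    where
    c r q : ℕ
    c = count f P
    r = n % P
    q = n / P
    r≤P : r ≤ P
    r≤P = <⇒≤ (m%n<n n P)
    n≡r+qP : n ≡ r + q * P
    n≡r+qP = m≡m%n+[m/n]*n n P

  linear-bounds-shifted : ∀ {f P} .{{_ : NonZero P}} → Periodic f P → ∀ N →
    WithinLine P (count f P) (P + P * P) N (count f (suc N))
  linear-bounds-shifted {f} {P} per N with linear-bounds per (suc N)
  ... | upper , lower = upper′ , lower′
    where
    open ≤-Reasoning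
    c : ℕ
    c = count f P
    upper′ : P * count f (suc N) ≤ c * N + (P + P * P)
    upper′ = begin
      P * count f (suc N)     ≤⟨ upper ⟩
      c * suc N + P * P       ≡⟨ cong (_+ P * P) (trans (*-suc c N) (+-comm c (c * N))) ⟩
      c * N + c + P * P       ≡⟨ +-assoc (c * N) c (P * P) ⟩
      c * N + (c + P * P)     ≤⟨ +-monoʳ-≤ (c * N) (+-monoˡ-≤ (P * P) (count≤ f P)) ⟩
      c * N + (P + P * P)     ∎
    lower′ : c * N ≤ P * count f (suc N) + (P + P * P)
    lower′ = begin
      c * N                             ≤⟨ *-monoʳ-≤ c (n≤1+n N) ⟩
      c * suc N                         ≤⟨ lower ⟩
      P * count f (suc N) + P * P       ≤⟨ +-monoʳ-≤ (P * count f (suc N)) (m≤n+m (P * P) P) ⟩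
      P * count f (suc N) + (P + P * P) ∎

  -- The parities of p(·,k) are periodic: p(·,1) is constant, and the
  -- mod-2 recurrence lifts a period from k to k+1.
  oddness-periodic : ∀ k → Σ ℕ λ P′ → Periodic (oddness (suc k)) (suc P′)
  oddness-periodic zero    = 0 , λ n → trans (oddness-parts≤1 (n + 1)) (sym (oddness-parts≤1 n))
  oddness-periodic (suc k) with oddness-periodic k
  ... | P′ , per =
    _ , period-lift {a = oddness (suc k)} {b = oddness (suc (suc k))} (oddness-recurrence (suc k)) per

  triangular : ℕ → ℕ
  triangular zero    = 0
  triangular (suc k) = suc k + triangular k

  triangular-double : ∀ k → k * (k + 1) ≡ 2 * triangular k
  triangular-double zero    = refl
  triangular-double (suc k) = begin
    suc k * (suc k + 1)           ≡⟨ expand k ⟩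
    2 * suc k + k * (k + 1)       ≡⟨ cong (2 * suc k +_) (triangular-double k) ⟩
    2 * suc k + 2 * triangular k  ≡⟨ *-distribˡ-+ 2 (suc k) (triangular k) ⟨
    2 * triangular (suc k)        ∎
    where
    open ≡-Reasoning
    expand : ∀ k → suc k * (suc k + 1) ≡ 2 * suc k + k * (k + 1)
    expand = solve-∀

  oddness-window : ∀ k → OddInEveryWindow (oddness (suc k)) (triangular (suc k))
  oddness-window zero    t = 0 , s≤s z≤n , oddness-parts≤1 (t + 0)
  oddness-window (suc k)   = window-lift {a = oddness (suc k)} {b = oddness (suc (suc k))}
                               (oddness-recurrence (suc k)) (oddness-window k)

  oddCount≡count : ∀ k N → oddCount k N ≡ count (oddness k) (suc N)
  oddCount≡count k N = begin
    length (filter (λ n → p n k % 2 ≟ 1) (upTo (suc N)))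
      ≡⟨ cong length (filter-≐ (λ n → p n k % 2 ≟ 1) (λ n → oddness k n ℙP.≟ 1ℙ)
                                ((λ {n} → odd⇒1ℙ (p n k)) , (λ {n} → 1ℙ⇒odd (p n k))) (upTo (suc N))) ⟩
    length (filter (λ n → oddness k n ℙP.≟ 1ℙ) (upTo (suc N)))
      ≡⟨ count-filter (oddness k) (suc N) ⟩
    count (oddness k) (suc N) ∎
    where
    open ≡-Reasoning
    value1⇒1ℙ : ∀ x → parityValue x ≡ 1 → x ≡ 1ℙ
    value1⇒1ℙ 1ℙ _ = refl
    odd⇒1ℙ : ∀ n → n % 2 ≡ 1 → parity n ≡ 1ℙ
    odd⇒1ℙ n h = value1⇒1ℙ (parity n) (trans (sym (%2≡parityValue n)) h)
    1ℙ⇒odd : ∀ n → parity n ≡ 1ℙ → n % 2 ≡ 1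
    1ℙ⇒odd n h = trans (%2≡parityValue n) (cong parityValue h)

  oddCount-bounds : ∀ {k P} .{{_ : NonZero P}} → Periodic (oddness k) P → ∀ N →
    WithinLine P (count (oddness k) P) (P + P * P) N (oddCount k N)
  oddCount-bounds {k} per N rewrite oddCount≡count k N = linear-bounds-shifted per N

  oddCount-density : ∀ k N → let d = suc k * (suc k + 1) in 2 * N ≤ d * oddCount (suc k) N + d
  oddCount-density k N = begin
    2 * N                       ≤⟨ *-monoʳ-≤ 2 N≤Tc+T ⟩
    2 * (T * c + T)             ≡⟨ distribute T c ⟩
    2 * T * c + 2 * T           ≡⟨ cong (λ x → x * c + x) (triangular-double (suc k)) ⟨
    d * c + d                   ≡⟨ cong (λ x → d * x + d) (oddCount≡count (suc k) N) ⟨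
    d * oddCount (suc k) N + d  ∎
    where
    open ≤-Reasoning
    T c d : ℕ
    T = triangular (suc k)
    c = count (oddness (suc k)) (suc N)
    d = suc k * (suc k + 1)
    N≤Tc+T : N ≤ T * c + T
    N≤Tc+T = ≤-trans (n≤1+n N) (<⇒≤ (window-density (oddness-window k) (suc N)))
    distribute : ∀ T c → 2 * (T * c + T) ≡ 2 * T * c + 2 * T
    distribute = solve-∀

module FractionBounds where

  open import Defs using (ratio)
  open import Data.Nat as ℕ using (ℕ; suc; s≤s; NonZero)
  import Data.Nat.Properties as ℕP
  open Inequalities using (WithinLine; cauchy-cross; above-cross)
  open import Data.Integer as ℤ using (+_; +[1+_]; +0; -[1+_])
  import Data.Integer.Properties as ℤP
  open import Data.Integer.Tactic.RingSolver using (solve-∀)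
  open import Data.Rational as ℚ using (ℚ; mkℚ; 0ℚ; toℚᵘ; _<_; _≤_; _-_; -_; ∣_∣)
  import Data.Rational.Properties as ℚP
  open import Data.Rational.Unnormalised as ℚᵘ using (mkℚᵘ; *<*; *≤*; _≃_)
  import Data.Rational.Unnormalised.Properties as ℚᵘP
  open import Algebra.Properties.AbelianGroup ℚP.+-0-abelianGroup using (⁻¹-anti-homo‿-)
  open import Data.Product using (Σ; _,_; proj₁; proj₂)
  open import Data.Sum using (inj₁; inj₂)
  open import Relation.Binary.PropositionalEquality

  -- x is the fraction a/(m+1), up to normalisation.
  record IsFraction (x : ℚ) (a m : ℕ) : Set where
    constructor fraction
    field unnormalised : toℚᵘ x ≃ mkℚᵘ (+ a) m

  ratio-isFraction : ∀ a m → IsFraction (ratio a (suc m)) a m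
  ratio-isFraction a m = fraction (ℚP.toℚᵘ-fromℚᵘ (mkℚᵘ (+ a) m))

  positive-isFraction : ∀ {ε} → 0ℚ < ε → Σ ℕ λ e → Σ ℕ λ f → IsFraction ε (suc e) f
  positive-isFraction {mkℚ +[1+ e ] f _} _ = e , f , fraction ℚᵘP.≃-refl
  positive-isFraction {mkℚ +0 _ _}        0<ε with ℚ.positive 0<ε
  ... | ()
  positive-isFraction {mkℚ -[1+ _ ] _ _}  0<ε with ℚ.positive 0<ε
  ... | ()

  scaled-numerator : ∀ a b M N F →
    (+ a ℤ.* + N ℤ.+ ℤ.- + b ℤ.* + M) ℤ.* + F ≡ + (a ℕ.* N ℕ.* F) ℤ.- + (b ℕ.* M ℕ.* F)
  scaled-numerator a b M N F = trans (distribute (+ a) (+ b) (+ M) (+ N) (+ F))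
    (cong₂ ℤ._-_ (trans (cong (ℤ._* + F) (sym (ℤP.pos-* a N))) (sym (ℤP.pos-* (a ℕ.* N) F)))
                 (trans (cong (ℤ._* + F) (sym (ℤP.pos-* b M))) (sym (ℤP.pos-* (b ℕ.* M) F))))
    where
    distribute : ∀ A B M N F → (A ℤ.* N ℤ.+ ℤ.- B ℤ.* M) ℤ.* F ≡ A ℤ.* N ℤ.* F ℤ.- B ℤ.* M ℤ.* F
    distribute = solve-∀

  sub-<-ℤ : ∀ u v w → u ℕ.< v ℕ.+ w → + u ℤ.- + w ℤ.< + v
  sub-<-ℤ u v w h = subst (+ u ℤ.- + w ℤ.<_) (cancel (+ v) (+ w))
    (ℤP.+-monoˡ-< (ℤ.- + w) (subst (+ u ℤ.<_) (ℤP.pos-+ v w) (ℤ.+<+ h)))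
    where
    cancel : ∀ V W → V ℤ.+ W ℤ.- W ≡ V
    cancel = solve-∀

  sub-≤-ℤ : ∀ u v w → u ℕ.≤ v ℕ.+ w → + u ℤ.- + w ℤ.≤ + v
  sub-≤-ℤ u v w h = subst (+ u ℤ.- + w ℤ.≤_) (cancel (+ v) (+ w))
    (ℤP.+-monoˡ-≤ (ℤ.- + w) (subst (+ u ℤ.≤_) (ℤP.pos-+ v w) (ℤ.+≤+ h)))
    where
    cancel : ∀ V W → V ℤ.+ W ℤ.- W ≡ V
    cancel = solve-∀

  toℚᵘ-sub : ∀ {x y a m b n} → IsFraction x a m → IsFraction y b n →
    toℚᵘ (x - y) ≃ mkℚᵘ (+ a) m ℚᵘ.- mkℚᵘ (+ b) n
  toℚᵘ-sub {x} {y} (fraction x≃) (fraction y≃) = ℚᵘP.≃-trans (ℚP.toℚᵘ-homo-+ x (- y))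
    (ℚᵘP.+-cong x≃ (ℚᵘP.≃-trans (ℚP.toℚᵘ-homo‿- y) (ℚᵘP.-‿cong y≃)))

  sub-< : ∀ {x y z a m b n c f} → IsFraction x a m → IsFraction y b n → IsFraction z c f →
    a ℕ.* suc n ℕ.* suc f ℕ.< c ℕ.* (suc m ℕ.* suc n) ℕ.+ b ℕ.* suc m ℕ.* suc f →
    x - y < z
  sub-< {a = a} {m} {b} {n} {c} {f} x≃ y≃ (fraction z≃) h =
    ℚP.toℚᵘ-cancel-< (ℚᵘP.<-respʳ-≃ (ℚᵘP.≃-sym z≃) (ℚᵘP.<-respˡ-≃ (ℚᵘP.≃-sym (toℚᵘ-sub x≃ y≃))
      (*<* (subst₂ ℤ._<_ (sym (scaled-numerator a b (suc m) (suc n) (suc f)))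
                         (ℤP.pos-* c (suc m ℕ.* suc n)) (sub-<-ℤ _ _ _ h)))))

  sub-≤ : ∀ {x y z a m b n c f} → IsFraction x a m → IsFraction y b n → IsFraction z c f →
    a ℕ.* suc n ℕ.* suc f ℕ.≤ c ℕ.* (suc m ℕ.* suc n) ℕ.+ b ℕ.* suc m ℕ.* suc f →
    x - y ≤ z
  sub-≤ {a = a} {m} {b} {n} {c} {f} x≃ y≃ (fraction z≃) h =
    ℚP.toℚᵘ-cancel-≤ (ℚᵘP.≤-respʳ-≃ (ℚᵘP.≃-sym z≃) (ℚᵘP.≤-respˡ-≃ (ℚᵘP.≃-sym (toℚᵘ-sub x≃ y≃))
      (*≤* (subst₂ ℤ._≤_ (sym (scaled-numerator a b (suc m) (suc n) (suc f)))
                         (ℤP.pos-* c (suc m ℕ.* suc n)) (sub-≤-ℤ _ _ _ h)))))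

  ∣-∣<-from-both : ∀ {x y ε} → x - y < ε → y - x < ε → ∣ x - y ∣ < ε
  ∣-∣<-from-both {x} {y} {ε} h₁ h₂ with ℚP.∣p∣≡p∨∣p∣≡-p (x - y)
  ... | inj₁ eq = subst (_< ε) (sym eq) h₁
  ... | inj₂ eq = subst (_< ε) (sym (trans eq (⁻¹-anti-homo‿- x y))) h₂

  ratio-cauchy : ∀ (a : ℕ → ℕ) P c K .{{_ : NonZero P}} →
    (∀ N → WithinLine P c K N (a N)) →
    (ε : ℚ) → 0ℚ < ε → Σ ℕ λ N₀ → (M N : ℕ) → M ℕ.≥ N₀ → N ℕ.≥ N₀ →
      ∣ ratio (a M) M - ratio (a N) N ∣ < ε
  ratio-cauchy a P c K bounds ε 0<ε with positive-isFraction 0<ε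
  ... | e , f , ε≃ = suc (2 ℕ.* K ℕ.* suc f) , close
    where
    difference< : ∀ M N → 2 ℕ.* K ℕ.* suc f ℕ.< suc M → 2 ℕ.* K ℕ.* suc f ℕ.< suc N →
      ratio (a (suc M)) (suc M) - ratio (a (suc N)) (suc N) < ε
    difference< M N M-large N-large =
      sub-< (ratio-isFraction (a (suc M)) M) (ratio-isFraction (a (suc N)) N) ε≃
            (cauchy-cross {P} {c} {K} {suc f} {suc e} {suc M} {suc N} {a (suc M)} {a (suc N)}
                          (proj₁ (bounds (suc M))) (proj₂ (bounds (suc N))) M-large N-large)

    close : (M N : ℕ) → M ℕ.≥ suc (2 ℕ.* K ℕ.* suc f) → N ℕ.≥ suc (2 ℕ.* K ℕ.* suc f) →
      ∣ ratio (a M) M - ratio (a N) N ∣ < ε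
    close (suc M) (suc N) M-large N-large =
      ∣-∣<-from-both {ratio (a (suc M)) (suc M)} {ratio (a (suc N)) (suc N)}
        (difference< M N M-large N-large) (difference< N M N-large M-large)

  ratio-eventually-above : ∀ (a : ℕ → ℕ) u d w .{{_ : NonZero d}} →
    (∀ N → u ℕ.* N ℕ.≤ d ℕ.* a N ℕ.+ w) →
    (ε : ℚ) → 0ℚ < ε → Σ ℕ λ N₀ → (N : ℕ) → N ℕ.≥ N₀ → ratio u d - ε ≤ ratio (a N) N
  ratio-eventually-above a u (suc v) w bound ε 0<ε with positive-isFraction 0<ε
  ... | e , f , ε≃ = suc (w ℕ.* suc f) , above
    where
    above : (N : ℕ) → N ℕ.≥ suc (w ℕ.* suc f) → ratio u (suc v) - ε ≤ ratio (a N) N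
    above (suc N) (s≤s N-large) =
      sub-≤ {ratio u (suc v)} {ε} {ratio (a (suc N)) (suc N)}
            (ratio-isFraction u v) ε≃ (ratio-isFraction (a (suc N)) N)
            (above-cross {u} {suc v} {w} {a (suc N)} {suc N} {suc f} {suc e}
                         (bound (suc N)) (ℕP.≤-trans N-large (ℕP.n≤1+n N)))

open import Defs
open import Data.Nat using (ℕ; _≥_; _*_; _+_; suc)
open import Data.Product using (Σ; _×_; _,_)
open import Data.Rational using (ℚ; 0ℚ; _<_; _≤_; _-_; ∣_∣)
open PartitionParity using (count; oddness; oddness-periodic; oddCount-bounds; oddCount-density)
open FractionBounds using (ratio-cauchy; ratio-eventually-above)

-- With a period P of p(·,k) mod 2 and c = count(P) odd values per period,
-- P·oddCount(N) is within P + P² of c·N, which gives the Cauchy property;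
-- the window bound gives 2N ≤ d·oddCount(N) + d with d = k(k+1), hence
-- the limit is at least 2/d.
theorem1p3 : (k : ℕ) → k ≥ 1 →
    ((ε : ℚ) → 0ℚ < ε → Σ ℕ (λ N₀ → (M N : ℕ) → M ≥ N₀ → N ≥ N₀ →
        ∣ ratio (oddCount k M) M - ratio (oddCount k N) N ∣ < ε))
    × ((ε : ℚ) → 0ℚ < ε → Σ ℕ (λ N₀ → (N : ℕ) → N ≥ N₀ →
        ratio 2 (k * (k + 1)) - ε ≤ ratio (oddCount k N) N))
theorem1p3 (suc k) _ with oddness-periodic k
... | P′ , period =
    ratio-cauchy (oddCount (suc k)) P (count (oddness (suc k)) P) (P + P * P) (oddCount-bounds period)
  , ratio-eventually-above (oddCount (suc k)) 2 d d (oddCount-density k)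
  where
  P d : ℕ
  P = suc P′
  d = suc k * (suc k + 1)
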